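{- Let $\sigma$ be an invertible substitution of size $M\times M$ over a finite alphabet $A$, and let $\rho\ge 1$ be an integer. Suppose that every pattern $p\in\mathcal{L}(X^\sigma)$ whose support contains $\{0,\dots,\rho-1\}^2$ can be uniquely desubstituted by $\sigma$. Then for every integer $k\ge 1$, every pattern in $\mathcal{L}(X^\sigma)$ whose support contains $\{0,\dots,(\rho+1)M^{k-1}-2\}^2$ can be uniquely desubstituted by $\sigma^k$.
   Context: Patterns are elements $p\in A^D$ with $D\subseteq\mathbb{Z}^2$; configurations are elements of $A^{\mathbb{Z}^2}$. A pattern $p$ of support $D$ appears in $p'$ if there is $\vec u\in\mathbb{Z}^2$ with $p_{\vec v}=p'_{\vec v-\vec u}$ for all $\vec v\in D$. The shift is $\tau_{\vec u}(p)_{\vec v}=p_{\vec v-\vec u}$. A substitution of size $M\times N$ is a map $\sigma:A\to A^{\{0,\dots,M-1\}\times\{0,\dots,N-1\}}$, extended to patterns and configurations by $\sigma(p)_{(Mx+i,Ny+j)}=\sigma(p_{(x,y)})_{(i,j)}$ for $(x,y)$ in the support of $p$, $0\le i<M$, $0\le j<N$; $\sigma^k$ is the $k$-fold iterate. $\sigma$ is invertible if no two distinct letters have the same image. $X^\sigma$ is the set of configurations $c$ such that every finite pattern appearing in $c$ appears in $\sigma^k(a)$ for some $a\in A$, $k\in\mathbb{N}$; $\mathcal{L}(X^\sigma)$ is the set of all patterns appearing in some configuration of $X^\sigma$. For a substitution $\sigma'$ (here $\sigma$ or $\sigma^k$) of size $K\times L$, a pattern $p$ of support $D$ can be uniquely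 desubstituted by $\sigma'$ if there exists $\vec t\in\mathbb{Z}^2$, unique modulo $(K,L)$, such that $\tau_{\vec t}(\sigma'(c))|_D=p$ for some $c\in X^\sigma$. -}

module Defs where

open import Level using (Level) renaming (suc to lsuc; zero to lzero)
open import Data.Nat as ℕ using (ℕ; zero; suc; NonZero; _^_)
open import Data.Integer as ℤ using (ℤ; +_; _-_; _≤_; _<_; _/ℕ_; _%ℕ_)
open import Data.Integer.DivMod using (n%ℕd<d)
open import Data.Integer.Divisibility using (_∣_)
open import Data.Fin using (Fin; fromℕ<)
open import Data.Product using (Σ; ∃; _×_; _,_; proj₁; proj₂)
open import Data.List using (List)
open import Data.List.Membership.Propositional using (_∈_)
open import Relation.Binary.PropositionalEquality using (_≡_)

Pos : Set
Pos = ℤ × ℤ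

_-ᵥ_ : Pos → Pos → Pos
(a , b) -ᵥ (c , d) = (a - c , b - d)

Config : ℕ → Set
Config n = Pos → Fin n

record Pattern (n : ℕ) : Set₁ where
  field
    support : Pos → Set
    val     : (v : Pos) → support v → Fin n
open Pattern public

FinPattern : ℕ → Set
FinPattern n = List (Pos × Fin n)

Subst : ℕ → ℕ → Set
Subst n M = Fin n → Fin M → Fin M → Fin n

Invertible : ∀ {n M} → Subst n M → Set
Invertible σ = ∀ a b → (∀ i j → σ a i j ≡ σ b i j) → a ≡ b

-- σ applied to a configuration:  σ(c)_(Mx+i,My+j) = σ(c_(x,y))_(i,j)
subC : ∀ {n} M .{{_ : NonZero M}} → Subst n M → Config n → Config n
subC M σ c (X , Y) =
  σ (c (X /ℕ M , Y /ℕ M)) (fromℕ< (n%ℕd<d X M)) (fromℕ< (n%ℕd<d Y M))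

subCⁿ : ∀ {n} M .{{_ : NonZero M}} → Subst n M → ℕ → Config n → Config n
subCⁿ M σ zero    c = c
subCⁿ M σ (suc k) c = subC M σ (subCⁿ M σ k c)

const : ∀ {n} → Fin n → Config n
const a _ = a

InBox : ℕ → Pos → Set
InBox K (x , y) = (+ 0 ≤ x × x < + K) × (+ 0 ≤ y × y < + K)

-- the finite pattern q appears in the pattern σ^k(a) (support {0,…,M^k-1}²);
-- σ^k(a) is the restriction of σ^k(const a) to that box
AppearsInBlock : ∀ {n} M .{{_ : NonZero M}} → Subst n M → FinPattern n → ℕ → Fin n → Set
AppearsInBlock M σ q k a =
  ∃ λ (u : Pos) → ∀ {v b} → (v , b) ∈ q →
    InBox (M ^ k) (v -ᵥ u) × subCⁿ M σ k (const a) (v -ᵥ u) ≡ b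

FinAppearsIn : ∀ {n} → FinPattern n → Config n → Set
FinAppearsIn q c = ∃ λ (u : Pos) → ∀ {v b} → (v , b) ∈ q → c (v -ᵥ u) ≡ b

InX : ∀ {n} M .{{_ : NonZero M}} → Subst n M → Config n → Set
InX {n} M σ c = ∀ (q : FinPattern n) → FinAppearsIn q c →
                  ∃ λ (k : ℕ) → ∃ λ (a : Fin n) → AppearsInBlock M σ q k a

AppearsIn : ∀ {n} → Pattern n → Config n → Set
AppearsIn p c = ∃ λ (u : Pos) → ∀ v (d : support p v) → val p v d ≡ c (v -ᵥ u)

InLang : ∀ {n} M .{{_ : NonZero M}} → Subst n M → Pattern n → Set
InLang {n} M σ p = Σ (Config n) λ c → InX M σ c × AppearsIn p c

SupportContainsSquare : ∀ {n} → ℕ → Pattern n → Set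
SupportContainsSquare s p = ∀ i j → i ℕ.< s → j ℕ.< s → support p (+ i , + j)

DesubAt : ∀ {n} M .{{_ : NonZero M}} → Subst n M → ℕ → Pattern n → Pos → Set
DesubAt {n} M σ k p t = Σ (Config n) λ c → InX M σ c ×
  (∀ v (d : support p v) → subCⁿ M σ k c (v -ᵥ t) ≡ val p v d)

EqMod : ℕ → Pos → Pos → Set
EqMod K (a , b) (c , d) = (+ K ∣ (a - c)) × (+ K ∣ (b - d))

UniquelyDesub : ∀ {n} M .{{_ : NonZero M}} → Subst n M → ℕ → Pattern n → Set
UniquelyDesub M σ k p =
  (Σ Pos λ t → DesubAt M σ k p t) ×
  (∀ t t' → DesubAt M σ k p t → DesubAt M σ k p t' → EqMod (M ^ k) t t')

-- Suppose σ^(k+1)(c) and σ^(k+1)(c') show a pattern p whose support contains a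
-- square of side (ρ+1)M^k − 1, at offsets t and t'. The ρ × ρ corner of p already forces
-- t ≡ t' mod M, so t = r + M a and t' = r + M a'. Every σ-block of index w < (ρ+1)M^(k−1) − 1
-- lies inside that square (the common residue r costs at most one block), and since σ is
-- invertible such a block determines the letter it comes from: σ^k(c) and σ^k(c') show the same
-- pattern of side (ρ+1)M^(k−1) − 1 at offsets a and a'. By induction a ≡ a' mod M^k, whence
-- t ≡ t' mod M^(k+1). Existence is easier: recognizability applied to whole configurations
-- shows that every configuration of X^σ is a translate of the σ-image of another one.
module Submission where

open import Defs
open import Data.Nat using (ℕ; NonZero; _+_; _*_; _∸_; _^_; _≤_)
open import Data.Fin using (Fin; toℕ; fromℕ<)

open import Data.Nat as ℕ using (zero; suc; z≤n; s≤s)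
import Data.Nat.Properties as ℕP
open import Data.Integer as ℤ using (ℤ; +_; _-_; _/ℕ_; _%ℕ_; +<+; +≤+)
import Data.Integer.Properties as ℤP
open import Data.Integer.DivMod using (n%ℕd<d; a≡a%ℕn+[a/ℕn]*n)
import Data.Integer.Divisibility as ℤ∣
import Data.Integer.Divisibility.Signed as ℤ∣ₛ
open import Data.Integer.Tactic.RingSolver using (solve-∀)
open import Algebra.Properties.AbelianGroup ℤP.+-0-abelianGroup using (∙-cancelʳ)
open import Data.Fin.Properties using (toℕ<n; fromℕ<-cong; fromℕ<-toℕ)
open import Data.List using (map)
open import Data.List.Membership.Propositional using (_∈_)
open import Data.List.Membership.Propositional.Properties using (∈-map⁺; ∈-map⁻)
open import Data.Product using (Σ; ∃; _×_; _,_; proj₁; proj₂)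
open import Data.Unit using (⊤; tt)
open import Data.Empty using (⊥-elim)
open import Relation.Binary.Definitions using (tri<; tri≈; tri>)
open import Relation.Binary.PropositionalEquality

infixl 6 _+ᵥ_
infixl 7 _*ᵥ_

_+ᵥ_ : Pos → Pos → Pos
(a , b) +ᵥ (c , d) = (a ℤ.+ c , b ℤ.+ d)

_*ᵥ_ : Pos → ℤ → Pos
(a , b) *ᵥ k = (a ℤ.* k , b ℤ.* k)

-ᵥ-identityʳ : ∀ v → v -ᵥ (+ 0 , + 0) ≡ v
-ᵥ-identityʳ (a , b) = cong₂ _,_ (ℤP.+-identityʳ a) (ℤP.+-identityʳ b)

SupportContainsSquare-mono : ∀ {n s s'} {p : Pattern n} → s ≤ s' →
  SupportContainsSquare s' p → SupportContainsSquare s p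
SupportContainsSquare-mono s≤s' sq i j i<s j<s =
  sq i j (ℕP.<-≤-trans i<s s≤s') (ℕP.<-≤-trans j<s s≤s')

ρ≤[ρ+1]*M^k∸1 : ∀ ρ M k .{{_ : NonZero M}} → ρ ≤ (ρ + 1) * M ^ k ∸ 1
ρ≤[ρ+1]*M^k∸1 ρ M k = ℕP.≤-trans (ℕP.≤-reflexive (sym (ℕP.m+n∸n≡m ρ 1)))
  (ℕP.∸-monoˡ-≤ 1 (ℕP.m≤m*n (ρ + 1) (M ^ k) {{ℕP.m^n≢0 M k}}))

*-^-suc : ∀ a M k → a * M ^ k * M ≡ a * M ^ suc k
*-^-suc a M k = trans (ℕP.*-assoc a (M ^ k) M) (cong (a *_) (ℕP.*-comm (M ^ k) M))

cell-index-< : ∀ {M N i r w} → i ℕ.< M → r ℕ.< M → w ℕ.< N ∸ 1 → i + r + w * M ℕ.< N * M ∸ 1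
cell-index-< {M} {suc N} {i} {r} {w} i<M r<M w<N∸1 = ℕP.∸-monoˡ-≤ 1 (begin
  suc (suc (i + r + w * M)) ≡⟨ cong (λ z → suc (z + w * M)) (sym (ℕP.+-suc i r)) ⟩
  suc i + suc r + w * M     ≤⟨ ℕP.+-monoˡ-≤ (w * M) (ℕP.+-mono-≤ i<M r<M) ⟩
  M + M + w * M             ≡⟨ ℕP.+-assoc M M (w * M) ⟩
  suc (suc w) * M           ≤⟨ ℕP.*-monoˡ-≤ M (s≤s w<N∸1) ⟩
  suc N * M                 ∎)
  where open ℕP.≤-Reasoning

module _ (M : ℕ) .{{_ : NonZero M}} where

  private
    m : ℤ
    m = + M

  blockOf : Pos → Pos
  blockOf (x , y) = (x /ℕ M , y /ℕ M)

  +*-monoʳ-< : ∀ {r r' q q'} → r ℕ.< M → q ℤ.< q' → + r ℤ.+ q ℤ.* m ℤ.< + r' ℤ.+ q' ℤ.* m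
  +*-monoʳ-< {r} {r'} {q} {q'} r<M q<q' = begin-strict
    + r ℤ.+ q ℤ.* m    <⟨ ℤP.+-monoˡ-< (q ℤ.* m) (+<+ r<M) ⟩
    m ℤ.+ q ℤ.* m      ≡⟨ ℤP.suc-* q m ⟨
    ℤ.suc q ℤ.* m      ≤⟨ ℤP.*-monoʳ-≤-nonNeg m (ℤP.i<j⇒suc[i]≤j q<q') ⟩
    q' ℤ.* m           ≤⟨ ℤP.i≤j+i (q' ℤ.* m) (+ r') ⟩
    + r' ℤ.+ q' ℤ.* m  ∎
    where open ℤP.≤-Reasoning

  quotient-unique : ∀ {r r' q q'} → r ℕ.< M → r' ℕ.< M →
    + r ℤ.+ q ℤ.* m ≡ + r' ℤ.+ q' ℤ.* m → q ≡ q'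
  quotient-unique {q = q} {q'} r<M r'<M eq with ℤP.<-cmp q q'
  ... | tri< q<q' _ _ = ⊥-elim (ℤP.<⇒≢ (+*-monoʳ-< r<M q<q') eq)
  ... | tri≈ _ q≡q' _ = q≡q'
  ... | tri> _ _ q'<q = ⊥-elim (ℤP.<⇒≢ (+*-monoʳ-< r'<M q'<q) (sym eq))

  /ℕ-%ℕ-unique : ∀ {x q r} → r ℕ.< M → x ≡ + r ℤ.+ q ℤ.* m → x /ℕ M ≡ q × x %ℕ M ≡ r
  /ℕ-%ℕ-unique {x} {q} {r} r<M x≡ = x/M≡q , ℤP.+-injective (∙-cancelʳ (q ℤ.* m) _ _ same-quotient)
    where
    x≡% : x ≡ + (x %ℕ M) ℤ.+ (x /ℕ M) ℤ.* m
    x≡% = a≡a%ℕn+[a/ℕn]*n x M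
    x/M≡q : x /ℕ M ≡ q
    x/M≡q = quotient-unique (n%ℕd<d x M) r<M (trans (sym x≡%) x≡)
    same-quotient : + (x %ℕ M) ℤ.+ q ℤ.* m ≡ + r ℤ.+ q ℤ.* m
    same-quotient = subst (λ z → + (x %ℕ M) ℤ.+ z ℤ.* m ≡ _) x/M≡q (trans (sym x≡%) x≡)

  sub-*-decomposition : ∀ x u → x - u ℤ.* m ≡ + (x %ℕ M) ℤ.+ (x /ℕ M - u) ℤ.* m
  sub-*-decomposition x u = begin
    x - u ℤ.* m                                       ≡⟨ cong (_- u ℤ.* m) (a≡a%ℕn+[a/ℕn]*n x M) ⟩
    + (x %ℕ M) ℤ.+ x /ℕ M ℤ.* m - u ℤ.* m             ≡⟨ regroup (+ (x %ℕ M)) (x /ℕ M) u m ⟩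
    + (x %ℕ M) ℤ.+ (x /ℕ M - u) ℤ.* m                 ∎
    where
    open ≡-Reasoning
    regroup : ∀ r q u k → r ℤ.+ q ℤ.* k - u ℤ.* k ≡ r ℤ.+ (q - u) ℤ.* k
    regroup = solve-∀

  sub-+*-decomposition : ∀ v t u →
    v - (t ℤ.+ u ℤ.* m) ≡ + ((v - t) %ℕ M) ℤ.+ ((v - t) /ℕ M - u) ℤ.* m
  sub-+*-decomposition v t u =
    trans (regroup v t u m) (sub-*-decomposition (v - t) u)
    where
    regroup : ∀ v t u k → v - (t ℤ.+ u ℤ.* k) ≡ v - t - u ℤ.* k
    regroup = solve-∀

  congruent-residue : ∀ t t' → + M ℤ∣.∣ t - t' → ∃ λ a' → t' ≡ + (t %ℕ M) ℤ.+ a' ℤ.* m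
  congruent-residue t t' M∣t-t' with ℤ∣ₛ.∣ᵤ⇒∣ M∣t-t'
  ... | ℤ∣ₛ.divides e t-t'≡ = t /ℕ M - e ,
    trans (regroup t t') (trans (cong (t -_) t-t'≡) (sub-*-decomposition t e))
    where
    regroup : ∀ t t' → t' ≡ t - (t - t')
    regroup = solve-∀

  ∣-+* : ∀ K r a a' → + K ℤ∣.∣ a - a' → + (M * K) ℤ∣.∣ (r ℤ.+ a ℤ.* m) - (r ℤ.+ a' ℤ.* m)
  ∣-+* K r a a' K∣a-a' =
    subst₂ ℤ∣._∣_ K*m≡M*K (regroup r a a' m) (ℤ∣.*-monoˡ-∣ m {+ K} {a - a'} K∣a-a')
    where
    K*m≡M*K : + K ℤ.* m ≡ + (M * K)
    K*m≡M*K = trans (sym (ℤP.pos-* K M)) (cong +_ (ℕP.*-comm K M))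
    regroup : ∀ r a a' k → (a - a') ℤ.* k ≡ (r ℤ.+ a ℤ.* k) - (r ℤ.+ a' ℤ.* k)
    regroup = solve-∀

  sub-residue : ∀ i r w a →
    + (i + r + w * M) - (+ r ℤ.+ a ℤ.* m) ≡ + i ℤ.+ (+ w - a) ℤ.* m
  sub-residue i r w a = begin
    + (i + r + w * M) - (+ r ℤ.+ a ℤ.* m)
      ≡⟨ cong (_- (+ r ℤ.+ a ℤ.* m)) (trans (ℤP.pos-+ (i + r) (w * M))
           (cong₂ ℤ._+_ (ℤP.pos-+ i r) (ℤP.pos-* w M))) ⟩
    + i ℤ.+ + r ℤ.+ + w ℤ.* m - (+ r ℤ.+ a ℤ.* m)
      ≡⟨ regroup (+ i) (+ r) (+ w) a m ⟩
    + i ℤ.+ (+ w - a) ℤ.* m ∎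
    where
    open ≡-Reasoning
    regroup : ∀ i r w a k → i ℤ.+ r ℤ.+ w ℤ.* k - (r ℤ.+ a ℤ.* k) ≡ i ℤ.+ (w - a) ℤ.* k
    regroup = solve-∀

  +*-range : ∀ K {i Z} → i ℕ.< M → + 0 ℤ.≤ Z → Z ℤ.< + K →
    + 0 ℤ.≤ + i ℤ.+ Z ℤ.* m × + i ℤ.+ Z ℤ.* m ℤ.< + (M * K)
  +*-range K {i} {+ z} i<M _ (+<+ z<K) rewrite sym (ℤP.pos-* z M) | sym (ℤP.pos-+ i (z * M)) =
    +≤+ z≤n , +<+ (ℕP.<-≤-trans (ℕP.+-monoˡ-< (z * M) i<M)
                     (ℕP.≤-trans (ℕP.*-monoˡ-≤ M z<K) (ℕP.≤-reflexive (ℕP.*-comm K M))))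

  InBox-cell : ∀ K {i j X} → i ℕ.< M → j ℕ.< M → InBox K X → InBox (M * K) ((+ i , + j) +ᵥ X *ᵥ m)
  InBox-cell K i<M j<M ((0≤X , X<K) , (0≤Y , Y<K)) = +*-range K i<M 0≤X X<K , +*-range K j<M 0≤Y Y<K

  remainderOf : Pos → Pos
  remainderOf (x , y) = (+ (x %ℕ M) , + (y %ℕ M))

  remainder+block : ∀ t → t ≡ remainderOf t +ᵥ blockOf t *ᵥ m
  remainder+block (x , y) = cong₂ _,_ (a≡a%ℕn+[a/ℕn]*n x M) (a≡a%ℕn+[a/ℕn]*n y M)

  EqMod-remainder : ∀ t t' → EqMod (M ^ 1) t t' → ∃ λ a' → t' ≡ remainderOf t +ᵥ a' *ᵥ m
  EqMod-remainder (x , y) (x' , y') (M∣x-x' , M∣y-y')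
    with congruent-residue x x' (subst (λ K → + K ℤ∣.∣ x - x') (ℕP.*-identityʳ M) M∣x-x')
       | congruent-residue y y' (subst (λ K → + K ℤ∣.∣ y - y') (ℕP.*-identityʳ M) M∣y-y')
  ... | a₁ , x'≡ | a₂ , y'≡ = (a₁ , a₂) , cong₂ _,_ x'≡ y'≡

  EqMod-lift : ∀ K r a a' → EqMod K a a' → EqMod (M * K) (r +ᵥ a *ᵥ m) (r +ᵥ a' *ᵥ m)
  EqMod-lift K (r₁ , r₂) (a₁ , a₂) (a₁' , a₂') (K∣₁ , K∣₂) =
    ∣-+* K r₁ a₁ a₁' K∣₁ , ∣-+* K r₂ a₂ a₂' K∣₂

  module _ {n : ℕ} (σ : Subst n M) where

    subC-cell : ∀ (c : Config n) {i j} X (i<M : i ℕ.< M) (j<M : j ℕ.< M) →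
      subC M σ c ((+ i , + j) +ᵥ X *ᵥ m) ≡ σ (c X) (fromℕ< i<M) (fromℕ< j<M)
    subC-cell c (X , Y) i<M j<M with /ℕ-%ℕ-unique i<M refl | /ℕ-%ℕ-unique j<M refl
    ... | x/M≡X , x%M≡i | y/M≡Y , y%M≡j =
      cong₃ (λ a I J → σ (c a) I J) (cong₂ _,_ x/M≡X y/M≡Y)
            (fromℕ<-cong _ _ x%M≡i _ _) (fromℕ<-cong _ _ y%M≡j _ _)
      where
      cong₃ : ∀ {A B C D : Set} (f : A → B → C → D) {a a' b b' c c'} →
              a ≡ a' → b ≡ b' → c ≡ c' → f a b c ≡ f a' b' c'
      cong₃ f refl refl refl = refl

    subC-cell-toℕ : ∀ (c : Config n) X (i j : Fin M) →
      subC M σ c ((+ toℕ i , + toℕ j) +ᵥ X *ᵥ m) ≡ σ (c X) i j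
    subC-cell-toℕ c X i j = trans (subC-cell c X (toℕ<n i) (toℕ<n j))
      (cong₂ (σ (c X)) (fromℕ<-toℕ i (toℕ<n i)) (fromℕ<-toℕ j (toℕ<n j)))

    subC-cong : ∀ (c c' : Config n) v → c (blockOf v) ≡ c' (blockOf v) →
      subC M σ c v ≡ subC M σ c' v
    subC-cong c c' (x , y) eq = cong (λ a → σ a _ _) eq

    subC-translate : ∀ (c : Config n) v t u →
      subC M σ c (v -ᵥ (t +ᵥ u *ᵥ m)) ≡ subC M σ (λ w → c (w -ᵥ u)) (v -ᵥ t)
    subC-translate c (v₁ , v₂) (t₁ , t₂) (u₁ , u₂) =
      trans (cong (subC M σ c) (cong₂ _,_ (sub-+*-decomposition v₁ t₁ u₁)
                                          (sub-+*-decomposition v₂ t₂ u₂)))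
            (subC-cell c _ (n%ℕd<d (v₁ - t₁) M) (n%ℕd<d (v₂ - t₂) M))

    blocks-injective : Invertible σ → ∀ (c c' : Config n) X X' →
      (∀ (i j : Fin M) → subC M σ c ((+ toℕ i , + toℕ j) +ᵥ X *ᵥ m)
                       ≡ subC M σ c' ((+ toℕ i , + toℕ j) +ᵥ X' *ᵥ m)) →
      c X ≡ c' X'
    blocks-injective inv c c' X X' same = inv _ _ λ i j →
      trans (sym (subC-cell-toℕ c X i j)) (trans (same i j) (subC-cell-toℕ c' X' i j))

    -- The blocks under a finite pattern of σ(c) form a finite pattern of c; it lies in some
    -- σ^k(a), so the original pattern lies in σ^(k+1)(a).
    InX-subC : ∀ c → InX M σ c → InX M σ (subC M σ c)
    InX-subC c c∈X q (u , σc⊒q) = suc k , a , u +ᵥ u' *ᵥ m , λ {v} {b} v,b∈q →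
      let (inBox , value) = in-block (∈-map⁺ preimage v,b∈q)
          x = proj₁ (v -ᵥ u)
          y = proj₂ (v -ᵥ u)
      in subst (InBox (M * M ^ k))
           (sym (cong₂ _,_ (sub-+*-decomposition (proj₁ v) (proj₁ u) (proj₁ u'))
                           (sub-+*-decomposition (proj₂ v) (proj₂ u) (proj₂ u'))))
           (InBox-cell (M ^ k) (n%ℕd<d x M) (n%ℕd<d y M) inBox)
       , (begin
           subC M σ (subCⁿ M σ k (const a)) (v -ᵥ (u +ᵥ u' *ᵥ m))
             ≡⟨ subC-translate (subCⁿ M σ k (const a)) v u u' ⟩
           subC M σ (λ w → subCⁿ M σ k (const a) (w -ᵥ u')) (v -ᵥ u)
             ≡⟨ subC-cong (λ w → subCⁿ M σ k (const a) (w -ᵥ u')) c (v -ᵥ u) value ⟩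
           subC M σ c (v -ᵥ u)
             ≡⟨ σc⊒q v,b∈q ⟩
           b ∎)
      where
      open ≡-Reasoning
      preimage : Pos × Fin n → Pos × Fin n
      preimage (v , _) = (blockOf (v -ᵥ u) , c (blockOf (v -ᵥ u)))
      c⊒preimage : FinAppearsIn (map preimage q) c
      c⊒preimage = (+ 0 , + 0) , λ w,b∈ → preimage-value (∈-map⁻ preimage w,b∈)
        where
        preimage-value : ∀ {w b} → ∃ (λ e → e ∈ q × (w , b) ≡ preimage e) → c (w -ᵥ (+ 0 , + 0)) ≡ b
        preimage-value (_ , _ , refl) = cong c (-ᵥ-identityʳ _)
      block = c∈X (map preimage q) c⊒preimage
      k = proj₁ block
      a = proj₁ (proj₂ block)
      u' = proj₁ (proj₂ (proj₂ block))
      in-block = proj₂ (proj₂ (proj₂ block))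

    InX-subCⁿ : ∀ k c → InX M σ c → InX M σ (subCⁿ M σ k c)
    InX-subCⁿ zero c c∈X = c∈X
    InX-subCⁿ (suc k) c c∈X = InX-subC (subCⁿ M σ k c) (InX-subCⁿ k c c∈X)

    patternOf : (Pos → Set) → Config n → Pos → Pattern n
    patternOf D c u = record { support = D ; val = λ w _ → c (w -ᵥ u) }

    patternOf-InLang : ∀ D c → InX M σ c → ∀ u → InLang M σ (patternOf D c u)
    patternOf-InLang D c c∈X u = c , c∈X , u , λ _ _ → refl

    Recognizable : ℕ → ℕ → Set₁
    Recognizable k s = ∀ p → InLang M σ p → SupportContainsSquare s p → UniquelyDesub M σ k p

    module _ (inv : Invertible σ) (ρ : ℕ) (recognizable : Recognizable 1 ρ) where

      desub-exists : ∀ k p → InLang M σ p → Σ Pos (DesubAt M σ k p)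
      desub-exists zero p (c , c∈X , u , p≡c) = u , c , c∈X , λ v e → sym (p≡c v e)
      desub-exists (suc k) p (c , c∈X , u , p≡c) = t₀ +ᵥ t₁ *ᵥ m , c₁ , c₁∈X , λ v e → begin
          subC M σ (subCⁿ M σ k c₁) (v -ᵥ (t₀ +ᵥ t₁ *ᵥ m))
            ≡⟨ subC-translate (subCⁿ M σ k c₁) v t₀ t₁ ⟩
          subC M σ (λ w → subCⁿ M σ k c₁ (w -ᵥ t₁)) (v -ᵥ t₀)
            ≡⟨ subC-cong (λ w → subCⁿ M σ k c₁ (w -ᵥ t₁)) c₀ (v -ᵥ t₀) (σᵏc₁≡c₀ _) ⟩
          subC M σ c₀ (v -ᵥ t₀)
            ≡⟨ σc₀≡c v tt ⟩
          c (v -ᵥ u)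
            ≡⟨ p≡c v e ⟨
          val p v e ∎
        where
        open ≡-Reasoning
        level₁ = proj₁ (recognizable (patternOf (λ _ → ⊤) c u) (patternOf-InLang _ c c∈X u)
                                     (λ _ _ _ _ → tt))
        t₀ = proj₁ level₁
        c₀ = proj₁ (proj₂ level₁)
        σc₀≡c = proj₂ (proj₂ (proj₂ level₁))
        level₀ = desub-exists k (patternOf (λ _ → ⊤) c₀ (+ 0 , + 0))
                   (patternOf-InLang _ c₀ (proj₁ (proj₂ (proj₂ level₁))) (+ 0 , + 0))
        t₁ = proj₁ level₀
        c₁ = proj₁ (proj₂ level₀)
        c₁∈X = proj₁ (proj₂ (proj₂ level₀))
        σᵏc₁≡c₀ : ∀ w → subCⁿ M σ k c₁ (w -ᵥ t₁) ≡ c₀ w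
        σᵏc₁≡c₀ w = trans (proj₂ (proj₂ (proj₂ level₀)) w tt) (cong c₀ (-ᵥ-identityʳ w))

      preimages-agree : ∀ N (p : Pattern n) (d d' : Config n) (t t' a a' : Pos) →
        SupportContainsSquare (N * M ∸ 1) p →
        t  ≡ remainderOf t +ᵥ a  *ᵥ m → (∀ v e → subC M σ d  (v -ᵥ t)  ≡ val p v e) →
        t' ≡ remainderOf t +ᵥ a' *ᵥ m → (∀ v e → subC M σ d' (v -ᵥ t') ≡ val p v e) →
        ∀ w → InBox (N ∸ 1) w → d' (w -ᵥ a') ≡ d (w -ᵥ a)
      preimages-agree N p d d' t t' a a' sq t≡ σd≡p t'≡ σd'≡p
                      w@(+ w₁ , + w₂) ((_ , +<+ w₁<N∸1) , (_ , +<+ w₂<N∸1)) =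
        blocks-injective inv d' d (w -ᵥ a') (w -ᵥ a) same-block
        where
        open ≡-Reasoning
        r₁ = proj₁ t %ℕ M
        r₂ = proj₂ t %ℕ M
        letter : Fin M → Fin M → Pos
        letter i j = (+ (toℕ i + r₁ + w₁ * M) , + (toℕ j + r₂ + w₂ * M))
        letter∈p : ∀ i j → support p (letter i j)
        letter∈p i j = sq _ _ (cell-index-< {N = N} (toℕ<n i) (n%ℕd<d (proj₁ t) M) w₁<N∸1)
                              (cell-index-< {N = N} (toℕ<n j) (n%ℕd<d (proj₂ t) M) w₂<N∸1)
        letter-offset : ∀ i j s b → s ≡ remainderOf t +ᵥ b *ᵥ m →
          letter i j -ᵥ s ≡ (+ toℕ i , + toℕ j) +ᵥ (w -ᵥ b) *ᵥ m
        letter-offset i j _ (b₁ , b₂) refl =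
          cong₂ _,_ (sub-residue (toℕ i) r₁ w₁ b₁) (sub-residue (toℕ j) r₂ w₂ b₂)
        same-block : ∀ i j → subC M σ d' ((+ toℕ i , + toℕ j) +ᵥ (w -ᵥ a') *ᵥ m)
                           ≡ subC M σ d  ((+ toℕ i , + toℕ j) +ᵥ (w -ᵥ a)  *ᵥ m)
        same-block i j = begin
          subC M σ d' ((+ toℕ i , + toℕ j) +ᵥ (w -ᵥ a') *ᵥ m)
            ≡⟨ cong (subC M σ d') (letter-offset i j t' a' t'≡) ⟨
          subC M σ d' (letter i j -ᵥ t')
            ≡⟨ σd'≡p (letter i j) (letter∈p i j) ⟩
          val p (letter i j) (letter∈p i j)
            ≡⟨ σd≡p (letter i j) (letter∈p i j) ⟨
          subC M σ d (letter i j -ᵥ t)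
            ≡⟨ cong (subC M σ d) (letter-offset i j t a t≡) ⟩
          subC M σ d ((+ toℕ i , + toℕ j) +ᵥ (w -ᵥ a) *ᵥ m) ∎

      desub-unique : ∀ k p → InLang M σ p → SupportContainsSquare ((ρ + 1) * M ^ k ∸ 1) p →
        ∀ t t' → DesubAt M σ (suc k) p t → DesubAt M σ (suc k) p t' → EqMod (M ^ suc k) t t'
      desub-unique zero p p∈L sq =
        proj₂ (recognizable p p∈L (SupportContainsSquare-mono {p = p} (ρ≤[ρ+1]*M^k∸1 ρ M 0) sq))
      desub-unique (suc k) p p∈L sq t t' (c , c∈X , σc≡p) (c' , c'∈X , σc'≡p) =
        subst₂ (EqMod (M ^ suc (suc k))) (sym t≡) (sym t'≡)
          (EqMod-lift (M ^ suc k) (remainderOf t) a a' a≡a')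
        where
        d  = subCⁿ M σ (suc k) c
        d' = subCⁿ M σ (suc k) c'
        d∈X = InX-subCⁿ (suc k) c c∈X
        t≡t' : EqMod (M ^ 1) t t'
        t≡t' = proj₂ (recognizable p p∈L
                        (SupportContainsSquare-mono {p = p} (ρ≤[ρ+1]*M^k∸1 ρ M (suc k)) sq))
                 t t' (d , d∈X , σc≡p) (d' , InX-subCⁿ (suc k) c' c'∈X , σc'≡p)
        a = blockOf t
        t≡ = remainder+block t
        a' = proj₁ (EqMod-remainder t t' t≡t')
        t'≡ = proj₂ (EqMod-remainder t t' t≡t')
        N = (ρ + 1) * M ^ k
        agree : ∀ w → InBox (N ∸ 1) w → d' (w -ᵥ a') ≡ d (w -ᵥ a)
        agree = preimages-agree N p d d' t t' a a'
                  (subst (λ s → SupportContainsSquare (s ∸ 1) p) (sym (*-^-suc (ρ + 1) M k)) sq)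
                  t≡ σc≡p t'≡ σc'≡p
        a≡a' : EqMod (M ^ suc k) a a'
        a≡a' = desub-unique k (patternOf (InBox (N ∸ 1)) d a) (patternOf-InLang _ d d∈X a)
                 (λ i j i< j< → (+≤+ z≤n , +<+ i<) , (+≤+ z≤n , +<+ j<))
                 a a' (c , c∈X , λ _ _ → refl) (c' , c'∈X , agree)

      recognizable-^ : ∀ k → Recognizable (suc k) ((ρ + 1) * M ^ k ∸ 1)
      recognizable-^ k p p∈L sq = desub-exists (suc k) p p∈L , desub-unique k p p∈L sq

lemma11 : ∀ {n : ℕ} (M : ℕ) .{{_ : NonZero M}} (σ : Subst n M) → Invertible σ →
    (ρ : ℕ) → 1 ≤ ρ →
    (∀ (p : Pattern n) → InLang M σ p → SupportContainsSquare ρ p → UniquelyDesub M σ 1 p) →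
    ∀ (k : ℕ) → 1 ≤ k → ∀ (p : Pattern n) → InLang M σ p →
    SupportContainsSquare ((ρ + 1) * M ^ (k ∸ 1) ∸ 1) p → UniquelyDesub M σ k p
lemma11 M σ inv ρ _ recognizable (suc k) _ = recognizable-^ M σ inv ρ recognizable k
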